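{- Let $G$ be an ordered graph and let $a,b \in V(G)$ with $a < b$. If $G - a = G - b$, then $[a,b] = \{w \in V(G) : a \leqslant w \leqslant b\}$ is a semi-homogeneous block in $G$.
   Context: An ordered graph is a graph with a linear order on its vertices, identified with one on $[n]$ with the usual order; $G - v$ is the induced ordered subgraph on $V(G)\setminus\{v\}$ (identified with $[n-1]$). A semi-homogeneous block in an ordered graph $G$ on $[n]$ is a set $B$ of consecutive vertices such that, for some set $L \subset \mathbb{N}$ and all $x,y \in B$: $\Gamma(x)\setminus B = \Gamma(y)\setminus B$, and $xy \in E(G)$ if and only if $|x-y| \in L$. -}

module Defs where

open import Data.Nat using (ℕ; suc; _≤_; _∸_)
open import Data.Fin using (Fin; toℕ; punchIn)
open import Data.Bool using (Bool; false)
open import Data.Product using (Σ; _×_)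
open import Relation.Binary.PropositionalEquality using (_≡_)
open import Relation.Nullary using (¬_)

-- An ordered (simple) graph on the vertex set [n], identified with Fin n
-- with its usual order; adjacency is a Bool-valued symmetric irreflexive relation.
record OrdGraph (n : ℕ) : Set where
  field
    adj   : Fin n → Fin n → Bool
    sym   : ∀ x y → adj x y ≡ adj y x
    irrefl : ∀ x → adj x x ≡ false
open OrdGraph public

dist : ℕ → ℕ → ℕ
dist x y = (x ∸ y) Data.Nat.+ (y ∸ x)

-- G - v : the induced ordered subgraph on V(G) \ {v}, identified with [n-1]
-- via the order-preserving embedding punchIn v : Fin n → Fin (suc n).
delete : ∀ {n} → OrdGraph (suc n) → Fin (suc n) → Fin n → Fin n → Bool
delete G v i j = adj G (punchIn v i) (punchIn v j)

SameDeletion : ∀ {n} → OrdGraph (suc n) → Fin (suc n) → Fin (suc n) → Set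
SameDeletion G a b = ∀ i j → delete G a i j ≡ delete G b i j

InInterval : ∀ {n} → Fin n → Fin n → Fin n → Set
InInterval a b w = (toℕ a ≤ toℕ w) × (toℕ w ≤ toℕ b)

IsSemiHomogeneousInterval : ∀ {n} → OrdGraph n → Fin n → Fin n → Set
IsSemiHomogeneousInterval {n} G a b =
  Σ (ℕ → Bool) λ L →
    ∀ x y → InInterval a b x → InInterval a b y →
      ((∀ z → ¬ InInterval a b z → adj G x z ≡ adj G y z)
       × (adj G x y ≡ L (dist (toℕ x) (toℕ y))))

module Submission where

-- Write α < β for the positions of a < b.  Deleting a (resp. b)
-- re-indexes the vertices by punchIn: index i is sent to i when i lies below
-- the deleted vertex and to i+1 otherwise.  Comparing the two re-indexings,
-- G - a = G - b says that adjacency is unchanged when a vertex x with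
-- α ≤ x < β is moved to x+1, provided the other endpoint z is either outside
-- [α,β] (kept fixed) or also inside [α,β) (moved to z+1 as well).
--   * Moving one endpoint through [α,β] step by step shows that every x in
--     [α,β] has the same adjacency to a fixed outside vertex z as α has.
--   * Sliding both endpoints of a pair x ≤ y in [α,β] down together shows
--     adj x y = adj α (α + (y - x)), so L d := adj α (α + d) works.
-- The file first reads punchIn and adjacency on ℕ (so that "x+1" needs no
-- bound bookkeeping), proves a general "stable steps give a constant"
-- lemma, derives the two one-step invariances, and finally the theorem.

open import Defs hiding (sym)
open import Data.Fin using (Fin; _<_)
open import Data.Nat as ℕ using (ℕ; zero; suc; _+_; _∸_; _≤_; z≤n; s≤s; _<?_)
open import Data.Nat.Properties
open import Data.Fin as Fin using (toℕ; fromℕ<; punchIn)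
open import Data.Fin.Properties using (toℕ-fromℕ<; fromℕ<-toℕ; toℕ<n)
open import Data.Bool using (Bool; false)
open import Data.Product using (_,_)
open import Data.Sum using (_⊎_; inj₁; inj₂)
open import Data.Empty using (⊥-elim)
open import Relation.Nullary using (¬_; yes; no)
open import Relation.Binary.PropositionalEquality
  using (_≡_; refl; sym; trans; cong; cong₂; module ≡-Reasoning)

punch : ℕ → ℕ → ℕ
punch zero    i       = suc i
punch (suc c) zero    = zero
punch (suc c) (suc i) = suc (punch c i)

toℕ-punchIn : ∀ {n} (c : Fin (suc n)) (i : Fin n) →
  toℕ (punchIn c i) ≡ punch (toℕ c) (toℕ i)
toℕ-punchIn Fin.zero    i           = refl
toℕ-punchIn (Fin.suc c) Fin.zero    = refl
toℕ-punchIn (Fin.suc c) (Fin.suc i) = cong suc (toℕ-punchIn c i)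

punch-below : ∀ {c i} → i ℕ.< c → punch c i ≡ i
punch-below {suc c} {zero}  _         = refl
punch-below {suc c} {suc i} (s≤s i<c) = cong suc (punch-below i<c)

punch-above : ∀ {c i} → c ≤ i → punch c i ≡ suc i
punch-above {zero}          _         = refl
punch-above {suc c} {suc i} (s≤s c≤i) = cong suc (punch-above c≤i)

interval-constant : ∀ {ℓ} {X : Set ℓ} (f : ℕ → X) {α x} → α ≤ x →
  (∀ j → α ≤ j → j ℕ.< x → f (suc j) ≡ f j) → f x ≡ f α
interval-constant f {x = zero}  z≤n     step = refl
interval-constant f {x = suc x} α≤1+x step with m≤n⇒m<n∨m≡n α≤1+x
... | inj₂ refl        = refl
... | inj₁ (s≤s α≤x) =
  trans (step x α≤x ≤-refl)
        (interval-constant f α≤x (λ j α≤j j<x → step j α≤j (m<n⇒m<1+n j<x)))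

dist-of-≤ : ∀ {x y} → x ≤ y → dist x y ≡ y ∸ x
dist-of-≤ {x} {y} x≤y = cong (_+ (y ∸ x)) (m≤n⇒m∸n≡0 x≤y)

dist-comm : ∀ x y → dist x y ≡ dist y x
dist-comm x y = +-comm (x ∸ y) (y ∸ x)

module AdjacencyOnℕ {n} (G : OrdGraph (suc n)) where

  -- The adjacency of G on ℕ, with vertices beyond n isolated.
  adjℕ : ℕ → ℕ → Bool
  adjℕ i j with i <? suc n | j <? suc n
  ... | yes i<1+n | yes j<1+n = adj G (fromℕ< i<1+n) (fromℕ< j<1+n)
  ... | _         | _         = false

  adjℕ-toℕ : ∀ x y → adjℕ (toℕ x) (toℕ y) ≡ adj G x y
  adjℕ-toℕ x y with toℕ x <? suc n | toℕ y <? suc n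
  ... | yes p | yes q = cong₂ (adj G) (fromℕ<-toℕ x p) (fromℕ<-toℕ y q)
  ... | no ¬p | _     = ⊥-elim (¬p (toℕ<n x))
  ... | yes _ | no ¬q = ⊥-elim (¬q (toℕ<n y))

  delete-as-punch : ∀ (c : Fin (suc n)) {i j} (i<n : i ℕ.< n) (j<n : j ℕ.< n) →
    adjℕ (punch (toℕ c) i) (punch (toℕ c) j) ≡ delete G c (fromℕ< i<n) (fromℕ< j<n)
  delete-as-punch c i<n j<n = trans
    (cong₂ adjℕ (reindex i<n) (reindex j<n))
    (adjℕ-toℕ (punchIn c (fromℕ< i<n)) (punchIn c (fromℕ< j<n)))
    where
    reindex : ∀ {i} (i<n : i ℕ.< n) → punch (toℕ c) i ≡ toℕ (punchIn c (fromℕ< i<n))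
    reindex {i} i<n = sym (trans (toℕ-punchIn c (fromℕ< i<n))
                                 (cong (punch (toℕ c)) (toℕ-fromℕ< i<n)))

  module Interval (a b : Fin (suc n)) (same : SameDeletion G a b)
                  (α<β : toℕ a ℕ.< toℕ b) where

    α β : ℕ
    α = toℕ a
    β = toℕ b

    β≤n : β ≤ n
    β≤n = ≤-pred (toℕ<n b)

    deletion : ∀ {i j} → i ℕ.< n → j ℕ.< n →
      adjℕ (punch α i) (punch α j) ≡ adjℕ (punch β i) (punch β j)
    deletion i<n j<n = trans (delete-as-punch a i<n j<n)
      (trans (same _ _) (sym (delete-as-punch b i<n j<n)))

    Outside : ℕ → Set
    Outside z = z ℕ.< α ⊎ β ℕ.< z

    shift-outside : ∀ x z → α ≤ x → x ℕ.< β → z ≤ n → Outside z →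
      adjℕ (suc x) z ≡ adjℕ x z
    shift-outside x z α≤x x<β z≤last (inj₁ z<α) = begin
      adjℕ (suc x) z                 ≡⟨ cong₂ adjℕ (sym (punch-above α≤x)) (sym (punch-below z<α)) ⟩
      adjℕ (punch α x) (punch α z)   ≡⟨ deletion (<-≤-trans x<β β≤n) (<-≤-trans z<β β≤n) ⟩
      adjℕ (punch β x) (punch β z)   ≡⟨ cong₂ adjℕ (punch-below x<β) (punch-below z<β) ⟩
      adjℕ x z                       ∎
      where
      open ≡-Reasoning
      z<β = <-trans z<α α<β
    shift-outside x (suc z) α≤x x<β z<n (inj₂ (s≤s β≤z)) = begin
      adjℕ (suc x) (suc z)           ≡⟨ cong₂ adjℕ (sym (punch-above α≤x)) (sym (punch-above α≤z)) ⟩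
      adjℕ (punch α x) (punch α z)   ≡⟨ deletion (<-≤-trans x<β β≤n) z<n ⟩
      adjℕ (punch β x) (punch β z)   ≡⟨ cong₂ adjℕ (punch-below x<β) (punch-above β≤z) ⟩
      adjℕ x (suc z)                 ∎
      where
      open ≡-Reasoning
      α≤z = ≤-trans (<⇒≤ α<β) β≤z

    shift-inside : ∀ x y → α ≤ x → x ℕ.< β → α ≤ y → y ℕ.< β →
      adjℕ (suc x) (suc y) ≡ adjℕ x y
    shift-inside x y α≤x x<β α≤y y<β = begin
      adjℕ (suc x) (suc y)           ≡⟨ cong₂ adjℕ (sym (punch-above α≤x)) (sym (punch-above α≤y)) ⟩
      adjℕ (punch α x) (punch α y)   ≡⟨ deletion (<-≤-trans x<β β≤n) (<-≤-trans y<β β≤n) ⟩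
      adjℕ (punch β x) (punch β y)   ≡⟨ cong₂ adjℕ (punch-below x<β) (punch-below y<β) ⟩
      adjℕ x y                       ∎
      where open ≡-Reasoning

    outside-like-α : ∀ x z → α ≤ x → x ≤ β → z ≤ n → Outside z →
      adjℕ x z ≡ adjℕ α z
    outside-like-α x z α≤x x≤β z≤last out =
      interval-constant (λ t → adjℕ t z) α≤x
        (λ j α≤j j<x → shift-outside j z α≤j (<-≤-trans j<x x≤β) z≤last out)

    L : ℕ → Bool
    L d = adjℕ α (α + d)

    -- For α ≤ x ≤ y ≤ β, slide the pair (x, y) down to (α, α + (y - x)).
    inside-by-distance : ∀ x y → α ≤ x → x ≤ y → y ≤ β →
      adjℕ x y ≡ L (y ∸ x)
    inside-by-distance x y α≤x x≤y y≤β = begin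
      adjℕ x y         ≡⟨ cong (adjℕ x) (sym (m+[n∸m]≡n x≤y)) ⟩
      adjℕ x (x + d)   ≡⟨ interval-constant (λ t → adjℕ t (t + d)) α≤x step ⟩
      adjℕ α (α + d)   ∎
      where
      open ≡-Reasoning
      d = y ∸ x
      step : ∀ j → α ≤ j → j ℕ.< x → adjℕ (suc j) (suc (j + d)) ≡ adjℕ j (j + d)
      step j α≤j j<x = shift-inside j (j + d) α≤j (<-≤-trans j<x (≤-trans x≤y y≤β))
        (≤-trans α≤j (m≤m+n j d)) (<-≤-trans j+d<y y≤β)
        where
        j+d<y : j + d ℕ.< y
        j+d<y = <-≤-trans (+-monoˡ-< d j<x) (≤-reflexive (m+[n∸m]≡n x≤y))

    outside-neighbours : ∀ x y → InInterval a b x → InInterval a b y →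
      ∀ z → ¬ InInterval a b z → adj G x z ≡ adj G y z
    outside-neighbours x y (α≤x , x≤β) (α≤y , y≤β) z z∉ = begin
      adj G x z                ≡⟨ sym (adjℕ-toℕ x z) ⟩
      adjℕ (toℕ x) (toℕ z)     ≡⟨ outside-like-α _ _ α≤x x≤β z≤last z-outside ⟩
      adjℕ α (toℕ z)           ≡⟨ sym (outside-like-α _ _ α≤y y≤β z≤last z-outside) ⟩
      adjℕ (toℕ y) (toℕ z)     ≡⟨ adjℕ-toℕ y z ⟩
      adj G y z                ∎
      where
      open ≡-Reasoning
      z≤last = ≤-pred (toℕ<n z)
      z-outside : Outside (toℕ z)
      z-outside with α ℕ.≤? toℕ z
      ... | yes α≤z = inj₂ (≰⇒> (λ z≤β → z∉ (α≤z , z≤β)))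
      ... | no α≰z  = inj₁ (≰⇒> α≰z)

    inside-adjacency : ∀ x y → InInterval a b x → InInterval a b y →
      adj G x y ≡ L (dist (toℕ x) (toℕ y))
    inside-adjacency x y (α≤x , x≤β) (α≤y , y≤β) with ≤-total (toℕ x) (toℕ y)
    ... | inj₁ x≤y = begin
      adj G x y                    ≡⟨ sym (adjℕ-toℕ x y) ⟩
      adjℕ (toℕ x) (toℕ y)         ≡⟨ inside-by-distance _ _ α≤x x≤y y≤β ⟩
      L (toℕ y ∸ toℕ x)            ≡⟨ cong L (sym (dist-of-≤ x≤y)) ⟩
      L (dist (toℕ x) (toℕ y))     ∎
      where open ≡-Reasoning
    ... | inj₂ y≤x = begin
      adj G x y                    ≡⟨ OrdGraph.sym G x y ⟩
      adj G y x                    ≡⟨ sym (adjℕ-toℕ y x) ⟩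
      adjℕ (toℕ y) (toℕ x)         ≡⟨ inside-by-distance _ _ α≤y y≤x x≤β ⟩
      L (toℕ x ∸ toℕ y)            ≡⟨ cong L (sym (dist-of-≤ y≤x)) ⟩
      L (dist (toℕ y) (toℕ x))     ≡⟨ cong L (dist-comm (toℕ y) (toℕ x)) ⟩
      L (dist (toℕ x) (toℕ y))     ∎
      where open ≡-Reasoning

lemma5p4 : ∀ {n} (G : OrdGraph (suc n)) (a b : Fin (suc n)) →
    a < b → SameDeletion G a b → IsSemiHomogeneousInterval G a b
lemma5p4 G a b a<b same =
  L , λ x y x∈ y∈ → outside-neighbours x y x∈ y∈ , inside-adjacency x y x∈ y∈
  where open AdjacencyOnℕ.Interval G a b same a<b
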